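{- Let $s$ be a graphical sequence, let $F\in\mathcal{F}(s)$ and let $\tau$ be an f-switch over $F$. Then $|\operatorname{rank}(\tau(F))-\operatorname{rank}(F)|=|\operatorname{null}(\tau(F))-\operatorname{null}(F)|\in\{0,2\}$.
   Context: Graphs are finite, simple, undirected and labeled. For a graphical sequence $s=(d_1,\dots,d_n)$, $\mathcal{F}(s)$ is the set of forests with vertex set $[n]$ in which vertex $i$ has degree $d_i$. The rank and nullity of a graph are the rank and nullity of its (real) adjacency matrix. The 2-switch $\tau=\binom{a\ b}{c\ d}$ maps $G$ to $G-ab-cd+ac+bd$ if $ab,cd\in E(G)$, $\{a,b\}\cap\{c,d\}=\varnothing$ and $ac,bd\notin E(G)$ (then it is nontrivial for $G$), and to $G$ otherwise. A nontrivial 2-switch $\tau$ over a forest $F$ is an f-switch if $\tau(F)$ is a forest. -}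

module Defs where

open import Data.Nat using (ℕ; zero; suc)
import Data.Nat as ℕ
open import Data.Bool using (Bool; true; false; if_then_else_; _∧_; _∨_; not)
open import Data.Fin using (Fin; zero; suc; inject₁; fromℕ; _≟_)
open import Data.Rational using (ℚ; 0ℚ; 1ℚ; _+_; _*_)
open import Data.Product using (Σ; ∃; _×_)
open import Relation.Binary.PropositionalEquality using (_≡_; _≢_)
open import Relation.Nullary using (¬_)
open import Relation.Nullary.Decidable using (⌊_⌋)
open import Function.Definitions using (Injective)

Adj : ℕ → Set
Adj n = Fin n → Fin n → Bool

Simple : ∀ {n} → Adj n → Set
Simple {n} G = (∀ (i j : Fin n) → G i j ≡ G j i) × (∀ (i : Fin n) → G i i ≡ false)

sumℕ : ∀ {k} → (Fin k → ℕ) → ℕ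
sumℕ {zero} f = 0
sumℕ {suc k} f = f zero ℕ.+ sumℕ (λ i → f (suc i))

sumℚ : ∀ {k} → (Fin k → ℚ) → ℚ
sumℚ {zero} f = 0ℚ
sumℚ {suc k} f = f zero + sumℚ (λ i → f (suc i))

degree : ∀ {n} → Adj n → Fin n → ℕ
degree G i = sumℕ (λ j → if G i j then 1 else 0)

HasDegrees : ∀ {n} → Adj n → (Fin n → ℕ) → Set
HasDegrees {n} G s = ∀ (i : Fin n) → degree G i ≡ s i

Cycle : ∀ {n} → Adj n → Set
Cycle {n} G = Σ ℕ λ m → Σ (Fin (suc (suc (suc m))) → Fin n) λ v →
  Injective _≡_ _≡_ v ×
  (∀ (i : Fin (suc (suc m))) → G (v (inject₁ i)) (v (suc i)) ≡ true) ×
  (G (v (fromℕ (suc (suc m)))) (v zero) ≡ true)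

Forest : ∀ {n} → Adj n → Set
Forest G = Simple G × ¬ Cycle G

Graphical : ∀ {n} → (Fin n → ℕ) → Set
Graphical {n} s = Σ (Adj n) λ G → Simple G × HasDegrees G s

InForests : ∀ {n} → (Fin n → ℕ) → Adj n → Set
InForests s F = Forest F × HasDegrees F s

sameEdge : ∀ {n} → Fin n → Fin n → Fin n → Fin n → Bool
sameEdge x y u v = (⌊ x ≟ u ⌋ ∧ ⌊ y ≟ v ⌋) ∨ (⌊ x ≟ v ⌋ ∧ ⌊ y ≟ u ⌋)

switchRaw : ∀ {n} → Adj n → Fin n → Fin n → Fin n → Fin n → Adj n
switchRaw G a b c d x y =
  if sameEdge x y a b ∨ sameEdge x y c d then false
  else if sameEdge x y a c ∨ sameEdge x y b d then true
  else G x y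

Nontrivial : ∀ {n} → Adj n → Fin n → Fin n → Fin n → Fin n → Set
Nontrivial G a b c d =
  G a b ≡ true × G c d ≡ true ×
  a ≢ c × a ≢ d × b ≢ c × b ≢ d ×
  G a c ≡ false × G b d ≡ false

switch : ∀ {n} → Adj n → Fin n → Fin n → Fin n → Fin n → Adj n
switch G a b c d =
  if G a b ∧ G c d ∧ not ⌊ a ≟ c ⌋ ∧ not ⌊ a ≟ d ⌋
       ∧ not ⌊ b ≟ c ⌋ ∧ not ⌊ b ≟ d ⌋
       ∧ not (G a c) ∧ not (G b d)
  then switchRaw G a b c d else G

FSwitch : ∀ {n} → Adj n → Fin n → Fin n → Fin n → Fin n → Set
FSwitch F a b c d = Nontrivial F a b c d × Forest (switch F a b c d)

-- linear algebra over ℚ (the adjacency matrix has entries 0/1, and rank/nullity of a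
-- rational matrix are the same over ℚ and over ℝ)
Matrix : ℕ → Set
Matrix n = Fin n → Fin n → ℚ

adjMatrix : ∀ {n} → Adj n → Matrix n
adjMatrix G i j = if G i j then 1ℚ else 0ℚ

LinIndep : ∀ {k n} → (Fin k → Fin n → ℚ) → Set
LinIndep {k} {n} v = ∀ (c : Fin k → ℚ) →
  (∀ (j : Fin n) → sumℚ (λ i → c i * v i j) ≡ 0ℚ) → ∀ (i : Fin k) → c i ≡ 0ℚ

IsRank : ∀ {n} → Matrix n → ℕ → Set
IsRank {n} A r =
  (Σ (Fin r → Fin n) λ ρ → LinIndep (λ i → A (ρ i))) ×
  (∀ (ρ : Fin (suc r) → Fin n) → ¬ LinIndep (λ i → A (ρ i)))

InKernel : ∀ {n} → Matrix n → (Fin n → ℚ) → Set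
InKernel {n} A x = ∀ (i : Fin n) → sumℚ (λ j → A i j * x j) ≡ 0ℚ

IsNullity : ∀ {n} → Matrix n → ℕ → Set
IsNullity {n} A k =
  (Σ (Fin k → Fin n → ℚ) λ v → (∀ i → InKernel A (v i)) × LinIndep v) ×
  (∀ (v : Fin (suc k) → Fin n → ℚ) → (∀ i → InKernel A (v i)) → ¬ LinIndep v)

-- Over ℚ the adjacency matrix of a forest has even rank. A forest is 2-colourable (delete a leaf,
-- the end of a longest path), and for a symmetric matrix A whose nonzero entries join the two
-- colour classes, multiplication by A maps the span of the rows of either class injectively into
-- the span of the rows of the other (A y = 0 with y in the row space forces y · y = 0); so both
-- classes contribute the same dimension. A 2-switch changes A by a matrix of rank at most two, so
-- the two ranks differ by at most 2, hence by 0 or 2, and rank + nullity = n transfers this to the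
-- nullities. Rank and nullity are specified by maximality conditions, so spanning families are only
-- obtained under double negation; this is harmless because the conclusion is decidable.

module Submission where

open import Defs
open import Data.Nat as ℕ using (ℕ; zero; suc; _≤_; z≤n; s≤s; ∣_-_∣)
import Data.Nat.Properties as ℕₚ
open import Data.Nat.Tactic.RingSolver using (solve-∀)
open import Data.Bool as Bool using (Bool; true; false; not; if_then_else_; _∧_; _∨_)
open import Data.Bool.Properties using (¬-not; not-¬; not-involutive)
open import Data.Fin as Fin using (Fin; zero; suc; toℕ; fromℕ; inject₁; inject≤; punchIn; punchOut; _↑ˡ_; _↑ʳ_; splitAt; join)
open import Data.Fin.Properties
  using (any?; all?; ¬∀⟶∃¬; punchInᵢ≢i; punchIn-injective; punchIn-punchOut; punchOut-cong; join-splitAt; inject≤-injective;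
         injective⇒≤; toℕ-injective; toℕ<n; toℕ-fromℕ; toℕ-inject₁; toℕ-inject≤)
open import Data.Vec.Functional using (Vector; []; _∷_; _++_; insertAt)
open import Data.Vec.Functional.Properties using (lookup-++ˡ; lookup-++ʳ; insertAt-lookup; insertAt-punchIn)
import Data.Integer as ℤ
open import Data.Rational as ℚ using (ℚ; 0ℚ; 1ℚ; _+_; _*_; -_; _-_; 1/_; ≢-nonZero)
import Data.Rational.Properties as ℚₚ
open import Data.Rational.Solver using (module +-*-Solver)
open import Data.Product using (Σ; ∃; _×_; _,_; proj₁; proj₂)
open import Data.Sum as Sum using (_⊎_; inj₁; inj₂)
open import Data.Sum.Properties using ([,]-∘)
open import Data.Empty using (⊥-elim)
open import Function using (_∘_; _$_)
open import Function.Definitions using (Injective)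
open import Relation.Binary.PropositionalEquality
open import Relation.Nullary using (¬_; Dec; yes; no; _×-dec_; _⊎-dec_)
open import Relation.Nullary.Decidable using (⌊_⌋; decidable-stable)
open import Relation.Nullary.Negation using (contradiction; ¬¬-Monad)
open import Effect.Monad using (RawMonad)
open import Level using (0ℓ)

open +-*-Solver using (solve; _:=_; _:+_; _:*_; :-_; _:-_; con)
open RawMonad (¬¬-Monad {0ℓ}) using (pure; _>>=_)

zero-coefficient : ∀ {a} (w X : ℚ) → a ≡ 0ℚ → a * w + X ≡ X
zero-coefficient w X refl = trans (cong (_+ X) (ℚₚ.*-zeroˡ w)) (ℚₚ.+-identityˡ X)

zero-factor : ∀ {a} (x y : ℚ) → a ≡ 0ℚ → a * x ≡ a * y
zero-factor x y refl = trans (ℚₚ.*-zeroˡ x) (sym (ℚₚ.*-zeroˡ y))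

zero+≡0⇒≡0 : ∀ {a b} → a ≡ 0ℚ → a + b ≡ 0ℚ → b ≡ 0ℚ
zero+≡0⇒≡0 {b = b} refl a+b≡0 = trans (sym (ℚₚ.+-identityˡ b)) a+b≡0

ratio-cancel : ∀ a b .{{_ : ℚ.NonZero b}} → a - (a * 1/ b) * b ≡ 0ℚ
ratio-cancel a b = begin
  a - (a * 1/ b) * b ≡⟨ cong (λ s → a - s) (trans (ℚₚ.*-assoc a (1/ b) b) (cong (a *_) (ℚₚ.*-inverseˡ b))) ⟩
  a - a * 1ℚ         ≡⟨ cong (λ s → a - s) (ℚₚ.*-identityʳ a) ⟩
  a - a              ≡⟨ ℚₚ.+-inverseʳ a ⟩
  0ℚ                 ∎
  where open ≡-Reasoning

square-nonNeg : ∀ x → 0ℚ ℚ.≤ x * x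
square-nonNeg x@(ℚ.mkℚ (ℤ.+ _) _ _) = ℚₚ.nonNegative⁻¹ (x * x) {{ℚₚ.nonNeg*nonNeg⇒nonNeg x x}}
square-nonNeg x@(ℚ.mkℚ ℤ.-[1+ _ ] _ _) = ℚₚ.nonNegative⁻¹ (x * x) {{ℚₚ.nonPos*nonPos⇒nonPos x x}}

nonNeg+nonNeg≡0⇒≡0 : ∀ {a b} → 0ℚ ℚ.≤ a → 0ℚ ℚ.≤ b → a + b ≡ 0ℚ → a ≡ 0ℚ
nonNeg+nonNeg≡0⇒≡0 {a} a≥0 b≥0 a+b≡0 = ℚₚ.≤-antisym (begin
  a      ≡⟨ ℚₚ.+-identityʳ a ⟨
  a + 0ℚ ≤⟨ ℚₚ.+-monoʳ-≤ a b≥0 ⟩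
  a + _  ≡⟨ a+b≡0 ⟩
  0ℚ     ∎) a≥0
  where open ℚₚ.≤-Reasoning

square≡0⇒≡0 : ∀ x → x * x ≡ 0ℚ → x ≡ 0ℚ
square≡0⇒≡0 x x²≡0 with x ℚₚ.≟ 0ℚ
... | yes x≡0 = x≡0
... | no x≢0 = contradiction (begin
  x                ≡⟨ ℚₚ.*-identityˡ x ⟨
  1ℚ * x           ≡⟨ cong (_* x) (ℚₚ.*-inverseˡ x) ⟨
  (1/ x * x) * x   ≡⟨ ℚₚ.*-assoc (1/ x) x x ⟩
  1/ x * (x * x)   ≡⟨ cong (1/ x *_) x²≡0 ⟩
  1/ x * 0ℚ        ≡⟨ ℚₚ.*-zeroʳ (1/ x) ⟩
  0ℚ               ∎) x≢0
  where
  open ≡-Reasoning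
  instance _ = ≢-nonZero x≢0

sumℚ-cong : ∀ {k} {f g : Fin k → ℚ} → (∀ i → f i ≡ g i) → sumℚ f ≡ sumℚ g
sumℚ-cong {zero} e = refl
sumℚ-cong {suc k} e = cong₂ _+_ (e zero) (sumℚ-cong (e ∘ suc))

sumℚ-zero : ∀ {k} {f : Fin k → ℚ} → (∀ i → f i ≡ 0ℚ) → sumℚ f ≡ 0ℚ
sumℚ-zero {zero} e = refl
sumℚ-zero {suc k} e = cong₂ _+_ (e zero) (sumℚ-zero (e ∘ suc))

sumℚ-distrib-+ : ∀ {k} (f g : Fin k → ℚ) → sumℚ (λ i → f i + g i) ≡ sumℚ f + sumℚ g
sumℚ-distrib-+ {zero} f g = refl
sumℚ-distrib-+ {suc k} f g =
  trans (cong (f zero + g zero +_) (sumℚ-distrib-+ (f ∘ suc) (g ∘ suc)))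
        (solve 4 (λ a b c d → (a :+ b) :+ (c :+ d) := (a :+ c) :+ (b :+ d)) refl (f zero) (g zero) _ _)

sumℚ-distrib-- : ∀ {k} (f g : Fin k → ℚ) → sumℚ (λ i → f i - g i) ≡ sumℚ f - sumℚ g
sumℚ-distrib-- {zero} f g = refl
sumℚ-distrib-- {suc k} f g =
  trans (cong (f zero - g zero +_) (sumℚ-distrib-- (f ∘ suc) (g ∘ suc)))
        (solve 4 (λ a b c d → (a :- b) :+ (c :- d) := (a :+ c) :- (b :+ d)) refl (f zero) (g zero) _ _)

*-distribˡ-sumℚ : ∀ {k} (a : ℚ) (f : Fin k → ℚ) → sumℚ (λ i → a * f i) ≡ a * sumℚ f
*-distribˡ-sumℚ {zero} a f = sym (ℚₚ.*-zeroʳ a)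
*-distribˡ-sumℚ {suc k} a f =
  trans (cong (a * f zero +_) (*-distribˡ-sumℚ a (f ∘ suc))) (sym (ℚₚ.*-distribˡ-+ a _ _))

*-distribʳ-sumℚ : ∀ {k} (a : ℚ) (f : Fin k → ℚ) → sumℚ (λ i → f i * a) ≡ sumℚ f * a
*-distribʳ-sumℚ a f =
  trans (sumℚ-cong (λ i → ℚₚ.*-comm (f i) a)) (trans (*-distribˡ-sumℚ a f) (ℚₚ.*-comm a _))

sumℚ-comm : ∀ {k m} (f : Fin k → Fin m → ℚ) →
  sumℚ (λ i → sumℚ (λ j → f i j)) ≡ sumℚ (λ j → sumℚ (λ i → f i j))
sumℚ-comm {zero} {m} f = sym (sumℚ-zero {m} (λ _ → refl))
sumℚ-comm {suc k} f =
  trans (cong (sumℚ (f zero) +_) (sumℚ-comm (f ∘ suc))) (sym (sumℚ-distrib-+ (f zero) _))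

sumℚ-remove : ∀ {k} (f : Fin (suc k) → ℚ) (p : Fin (suc k)) → sumℚ f ≡ f p + sumℚ (f ∘ punchIn p)
sumℚ-remove f zero = refl
sumℚ-remove {suc k} f (suc p) =
  trans (cong (f zero +_) (sumℚ-remove (f ∘ suc) p))
        (solve 3 (λ a b c → a :+ (b :+ c) := b :+ (a :+ c)) refl (f zero) (f (suc p)) _)

sumℚ-single : ∀ {k} (f : Fin k → ℚ) (p : Fin k) → (∀ i → i ≢ p → f i ≡ 0ℚ) → sumℚ f ≡ f p
sumℚ-single {suc k} f p e = begin
  sumℚ f                     ≡⟨ sumℚ-remove f p ⟩
  f p + sumℚ (f ∘ punchIn p) ≡⟨ cong (f p +_) (sumℚ-zero (λ j → e _ (punchInᵢ≢i p j))) ⟩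
  f p + 0ℚ                   ≡⟨ ℚₚ.+-identityʳ _ ⟩
  f p                        ∎
  where open ≡-Reasoning

sumℚ-++ : ∀ a {b} (f : Fin (a ℕ.+ b) → ℚ) → sumℚ f ≡ sumℚ (λ i → f (i ↑ˡ b)) + sumℚ (λ j → f (a ↑ʳ j))
sumℚ-++ zero f = sym (ℚₚ.+-identityˡ _)
sumℚ-++ (suc a) f = trans (cong (f zero +_) (sumℚ-++ a (f ∘ suc))) (sym (ℚₚ.+-assoc (f zero) _ _))

sumℚ-linear : ∀ {k} (f g : Fin k → ℚ) (b : ℚ) → sumℚ (λ i → f i - b * g i) ≡ sumℚ f - b * sumℚ g
sumℚ-linear f g b =
  trans (sumℚ-distrib-- f (λ i → b * g i)) (cong (λ s → sumℚ f - s) (*-distribˡ-sumℚ b g))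

sumℚ-nonNeg : ∀ {k} (f : Fin k → ℚ) → (∀ i → 0ℚ ℚ.≤ f i) → 0ℚ ℚ.≤ sumℚ f
sumℚ-nonNeg {zero} f _ = ℚₚ.≤-refl
sumℚ-nonNeg {suc k} f f≥0 = ℚₚ.+-mono-≤ (f≥0 zero) (sumℚ-nonNeg (f ∘ suc) (f≥0 ∘ suc))

lincomb : ∀ {p n} → Vector ℚ p → (Fin p → Vector ℚ n) → Vector ℚ n
lincomb c w t = sumℚ (λ i → c i * w i t)

InSpan : ∀ {p n} → (Fin p → Vector ℚ n) → Vector ℚ n → Set
InSpan {p} w x = Σ (Vector ℚ p) λ c → ∀ t → x t ≡ lincomb c w t

dot : ∀ {n} → Vector ℚ n → Vector ℚ n → ℚ
dot x y = sumℚ (λ t → x t * y t)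

lincomb-zeroˡ : ∀ {p n} (w : Fin p → Vector ℚ n) t → lincomb (λ _ → 0ℚ) w t ≡ 0ℚ
lincomb-zeroˡ w t = sumℚ-zero (λ i → ℚₚ.*-zeroˡ (w i t))

lincomb-linear : ∀ {p n} (a c : Vector ℚ p) (b : ℚ) (w : Fin p → Vector ℚ n) t →
  lincomb (λ i → a i - b * c i) w t ≡ lincomb a w t - b * lincomb c w t
lincomb-linear a c b w t =
  trans (sumℚ-cong (λ i → distrib (a i) (c i) (w i t)))
        (sumℚ-linear (λ i → a i * w i t) (λ i → c i * w i t) b)
  where
  distrib : ∀ x y z → (x - b * y) * z ≡ x * z - b * (y * z)
  distrib x y z = solve 4 (λ x y z b → (x :- b :* y) :* z := x :* z :- b :* (y :* z)) refl x y z b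

lincomb-neg : ∀ {p n} (c : Vector ℚ p) (w : Fin p → Vector ℚ n) t →
  lincomb (λ i → - c i) w t ≡ - lincomb c w t
lincomb-neg c w t =
  trans (sumℚ-cong (λ i → neg (c i) (w i t)))
        (trans (*-distribˡ-sumℚ (- 1ℚ) (λ i → c i * w i t)) (neg-one _))
  where
  neg : ∀ x y → - x * y ≡ - 1ℚ * (x * y)
  neg = solve 2 (λ x y → :- x :* y := (:- con 1ℚ) :* (x :* y)) refl
  neg-one : ∀ s → - 1ℚ * s ≡ - s
  neg-one = solve 1 (λ s → (:- con 1ℚ) :* s := :- s) refl

lincomb-++ : ∀ {p q n} (c : Vector ℚ (p ℕ.+ q)) (u : Fin p → Vector ℚ n) (v : Fin q → Vector ℚ n) t →
  lincomb c (u ++ v) t ≡ lincomb (λ i → c (i ↑ˡ q)) u t + lincomb (λ j → c (p ↑ʳ j)) v t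
lincomb-++ {p} c u v t = trans (sumℚ-++ p (λ i → c i * (u ++ v) i t))
  (cong₂ _+_ (sumℚ-cong (λ i → cong (λ w → c (i ↑ˡ _) * w t) (lookup-++ˡ u v i)))
             (sumℚ-cong (λ j → cong (λ w → c (p ↑ʳ j) * w t) (lookup-++ʳ u v j))))

lincomb-++-++ : ∀ {p q n} (c : Vector ℚ p) (d : Vector ℚ q) (u : Fin p → Vector ℚ n) (v : Fin q → Vector ℚ n) t →
  lincomb (c ++ d) (u ++ v) t ≡ lincomb c u t + lincomb d v t
lincomb-++-++ c d u v t = trans (lincomb-++ (c ++ d) u v t)
  (cong₂ _+_ (sumℚ-cong (λ i → cong (_* u i t) (lookup-++ˡ c d i)))
             (sumℚ-cong (λ j → cong (_* v j t) (lookup-++ʳ c d j))))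

lincomb-lincomb : ∀ {m p n} (c : Vector ℚ m) (g : Fin m → Vector ℚ p) (w : Fin p → Vector ℚ n) t →
  lincomb c (λ v → lincomb (g v) w) t ≡ lincomb (λ i → sumℚ (λ v → c v * g v i)) w t
lincomb-lincomb c g w t = begin
  sumℚ (λ v → c v * sumℚ (λ i → g v i * w i t))   ≡⟨ sumℚ-cong (λ v → *-distribˡ-sumℚ (c v) (λ i → g v i * w i t)) ⟨
  sumℚ (λ v → sumℚ (λ i → c v * (g v i * w i t))) ≡⟨ sumℚ-comm (λ v i → c v * (g v i * w i t)) ⟩
  sumℚ (λ i → sumℚ (λ v → c v * (g v i * w i t))) ≡⟨ sumℚ-cong (λ i → sumℚ-cong (λ v → ℚₚ.*-assoc (c v) (g v i) (w i t))) ⟨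
  sumℚ (λ i → sumℚ (λ v → c v * g v i * w i t))   ≡⟨ sumℚ-cong (λ i → *-distribʳ-sumℚ (w i t) (λ v → c v * g v i)) ⟩
  sumℚ (λ i → sumℚ (λ v → c v * g v i) * w i t)   ∎
  where open ≡-Reasoning

dot-comm : ∀ {n} (x y : Vector ℚ n) → dot x y ≡ dot y x
dot-comm x y = sumℚ-cong (λ t → ℚₚ.*-comm (x t) (y t))

dot-lincombˡ : ∀ {p n} (c : Vector ℚ p) (w : Fin p → Vector ℚ n) (y : Vector ℚ n) →
  dot (lincomb c w) y ≡ sumℚ (λ i → c i * dot (w i) y)
dot-lincombˡ c w y = begin
  sumℚ (λ t → sumℚ (λ i → c i * w i t) * y t)   ≡⟨ sumℚ-cong (λ t → *-distribʳ-sumℚ (y t) (λ i → c i * w i t)) ⟨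
  sumℚ (λ t → sumℚ (λ i → c i * w i t * y t))   ≡⟨ sumℚ-comm (λ t i → c i * w i t * y t) ⟩
  sumℚ (λ i → sumℚ (λ t → c i * w i t * y t))   ≡⟨ sumℚ-cong (λ i → sumℚ-cong (λ t → ℚₚ.*-assoc (c i) (w i t) (y t))) ⟩
  sumℚ (λ i → sumℚ (λ t → c i * (w i t * y t))) ≡⟨ sumℚ-cong (λ i → *-distribˡ-sumℚ (c i) (λ t → w i t * y t)) ⟩
  sumℚ (λ i → c i * dot (w i) y)                ∎
  where open ≡-Reasoning

dot-lincombʳ : ∀ {p n} (x : Vector ℚ n) (c : Vector ℚ p) (w : Fin p → Vector ℚ n) →
  dot x (lincomb c w) ≡ sumℚ (λ i → c i * dot x (w i))
dot-lincombʳ x c w = trans (dot-comm x _)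
  (trans (dot-lincombˡ c w x) (sumℚ-cong (λ i → cong (c i *_) (dot-comm (w i) x))))

dot-linearʳ : ∀ {n} (x a c : Vector ℚ n) (b : ℚ) → dot x (λ t → a t - b * c t) ≡ dot x a - b * dot x c
dot-linearʳ x a c b =
  trans (sumℚ-cong (λ t → distrib (x t) (a t) (c t)))
        (sumℚ-linear (λ t → x t * a t) (λ t → x t * c t) b)
  where
  distrib : ∀ x a c → x * (a - b * c) ≡ x * a - b * (x * c)
  distrib x a c = solve 4 (λ x a c b → x :* (a :- b :* c) := x :* a :- b :* (x :* c)) refl x a c b

dot-orthogonal : ∀ {p n} (c : Vector ℚ p) (w : Fin p → Vector ℚ n) (y : Vector ℚ n) →
  (∀ i → dot (w i) y ≡ 0ℚ) → dot (lincomb c w) y ≡ 0ℚ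
dot-orthogonal c w y w⊥y =
  trans (dot-lincombˡ c w y) (sumℚ-zero (λ i → trans (cong (c i *_) (w⊥y i)) (ℚₚ.*-zeroʳ (c i))))

InSpan-orthogonal : ∀ {p n} (w : Fin p → Vector ℚ n) {x y : Vector ℚ n} →
  InSpan w x → (∀ i → dot (w i) y ≡ 0ℚ) → dot x y ≡ 0ℚ
InSpan-orthogonal w {y = y} (c , x≡) w⊥y =
  trans (sumℚ-cong (λ t → cong (_* y t) (x≡ t))) (dot-orthogonal c w y w⊥y)

dot-self≡0 : ∀ {n} (x : Vector ℚ n) → dot x x ≡ 0ℚ → ∀ t → x t ≡ 0ℚ
dot-self≡0 {suc n} x x·x≡0 = λ where
    zero → square≡0⇒≡0 (x zero) x₀²≡0
    (suc t) → dot-self≡0 (x ∘ suc) tail≡0 t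
  where
  x₀²≡0 : x zero * x zero ≡ 0ℚ
  x₀²≡0 = nonNeg+nonNeg≡0⇒≡0 (square-nonNeg (x zero)) (sumℚ-nonNeg _ (square-nonNeg ∘ x ∘ suc)) x·x≡0
  tail≡0 : dot (x ∘ suc) (x ∘ suc) ≡ 0ℚ
  tail≡0 = zero+≡0⇒≡0 x₀²≡0 x·x≡0

InSpan-resp : ∀ {p n} {w : Fin p → Vector ℚ n} {x y : Vector ℚ n} → (∀ t → x t ≡ y t) → InSpan w x → InSpan w y
InSpan-resp x≡y (c , x≡) = c , λ t → trans (sym (x≡y t)) (x≡ t)

InSpan-zero : ∀ {p n} (w : Fin p → Vector ℚ n) → InSpan w (λ _ → 0ℚ)
InSpan-zero w = (λ _ → 0ℚ) , λ t → sym (lincomb-zeroˡ w t)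

InSpan-++ : ∀ {p q n} {u : Fin p → Vector ℚ n} {v : Fin q → Vector ℚ n} {x y : Vector ℚ n} →
  InSpan u x → InSpan v y → InSpan (u ++ v) (λ t → x t + y t)
InSpan-++ {u = u} {v} (c , x≡) (d , y≡) =
  c ++ d , λ t → trans (cong₂ _+_ (x≡ t) (y≡ t)) (sym (lincomb-++-++ c d u v t))

InSpan-++ˡ : ∀ {p q n} {u : Fin p → Vector ℚ n} (v : Fin q → Vector ℚ n) {x : Vector ℚ n} →
  InSpan u x → InSpan (u ++ v) x
InSpan-++ˡ v x∈u = InSpan-resp (λ t → ℚₚ.+-identityʳ _) (InSpan-++ x∈u (InSpan-zero v))

InSpan-++ʳ : ∀ {p q n} (u : Fin p → Vector ℚ n) {v : Fin q → Vector ℚ n} {x : Vector ℚ n} →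
  InSpan v x → InSpan (u ++ v) x
InSpan-++ʳ u x∈v = InSpan-resp (λ t → ℚₚ.+-identityˡ _) (InSpan-++ (InSpan-zero u) x∈v)

LinIndep-resp : ∀ {p n} {u v : Fin p → Vector ℚ n} → (∀ i t → u i t ≡ v i t) → LinIndep u → LinIndep v
LinIndep-resp u≡v ind c eq = ind c (λ t → trans (sumℚ-cong (λ i → cong (c i *_) (u≡v i t))) (eq t))

module _ {a b : ℕ} {f : Fin a → Fin b} (f-injective : Injective _≡_ _≡_ f) where

  pushforward-term : Vector ℚ a → Fin a → Fin b → ℚ
  pushforward-term c x y = if ⌊ f x Fin.≟ y ⌋ then c x else 0ℚ

  pushforward : Vector ℚ a → Vector ℚ b
  pushforward c y = sumℚ (λ x → pushforward-term c x y)

  pushforward-term-off : ∀ c x y → f x ≢ y → pushforward-term c x y ≡ 0ℚ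
  pushforward-term-off c x y fx≢y with f x Fin.≟ y
  ... | yes fx≡y = contradiction fx≡y fx≢y
  ... | no _ = refl

  pushforward-term-diag : ∀ c x → pushforward-term c x (f x) ≡ c x
  pushforward-term-diag c x with f x Fin.≟ f x
  ... | yes _ = refl
  ... | no fx≢fx = contradiction refl fx≢fx

  pushforward-∘ : ∀ c x → pushforward c (f x) ≡ c x
  pushforward-∘ c x = trans (sumℚ-single _ x (λ z z≢x → pushforward-term-off c z (f x) (z≢x ∘ f-injective)))
                            (pushforward-term-diag c x)

  lincomb-pushforward : ∀ {n} (c : Vector ℚ a) (u : Fin b → Vector ℚ n) t →
    lincomb (pushforward c) u t ≡ lincomb c (u ∘ f) t
  lincomb-pushforward c u t = begin
    sumℚ (λ y → pushforward c y * u y t)        ≡⟨ sumℚ-cong (λ y → *-distribʳ-sumℚ (u y t) (λ x → term x y)) ⟨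
    sumℚ (λ y → sumℚ (λ x → term x y * u y t))  ≡⟨ sumℚ-comm (λ y x → term x y * u y t) ⟩
    sumℚ (λ x → sumℚ (λ y → term x y * u y t))  ≡⟨ sumℚ-cong (λ x → sumℚ-single _ (f x) (off-diagonal x)) ⟩
    sumℚ (λ x → term x (f x) * u (f x) t)       ≡⟨ sumℚ-cong (λ x → cong (_* u (f x) t) (pushforward-term-diag c x)) ⟩
    sumℚ (λ x → c x * u (f x) t)                ∎
    where
    open ≡-Reasoning
    term = pushforward-term c
    off-diagonal : ∀ x y → y ≢ f x → term x y * u y t ≡ 0ℚ
    off-diagonal x y y≢fx =
      trans (cong (_* u y t) (pushforward-term-off c x y (y≢fx ∘ sym))) (ℚₚ.*-zeroˡ (u y t))

  LinIndep-∘-injective : ∀ {n} (u : Fin b → Vector ℚ n) → LinIndep u → LinIndep (u ∘ f)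
  LinIndep-∘-injective u ind c rel x = trans (sym (pushforward-∘ c x))
    (ind (pushforward c) (λ t → trans (lincomb-pushforward c u t) (rel t)) (f x))

LinIndep-inject≤ : ∀ {a b n} (u : Fin b → Vector ℚ n) (a≤b : a ≤ b) → LinIndep u → LinIndep (λ i → u (inject≤ i a≤b))
LinIndep-inject≤ u a≤b = LinIndep-∘-injective (inject≤-injective a≤b a≤b _ _) u

InSpan-of-relation : ∀ {p n} {x : Vector ℚ n} {u : Fin p → Vector ℚ n} (c : Vector ℚ (suc p)) →
  c zero ≢ 0ℚ → (∀ t → lincomb c (x ∷ u) t ≡ 0ℚ) → InSpan u x
InSpan-of-relation {x = x} {u} c c₀≢0 rel = (λ i → - (c (suc i) * c₀⁻¹)) , λ t → sym (begin
  sumℚ (λ i → - (c (suc i) * c₀⁻¹) * u i t)  ≡⟨ sumℚ-cong (λ i → regroup (c (suc i)) c₀⁻¹ (u i t)) ⟩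
  sumℚ (λ i → - c₀⁻¹ * (c (suc i) * u i t))  ≡⟨ *-distribˡ-sumℚ (- c₀⁻¹) (λ i → c (suc i) * u i t) ⟩
  - c₀⁻¹ * lincomb (c ∘ suc) u t             ≡⟨ cong (- c₀⁻¹ *_) (a+b≡0⇒b≡-a (c zero * x t) _ (rel t)) ⟩
  - c₀⁻¹ * - (c zero * x t)                  ≡⟨ cancel c₀⁻¹ (c zero) (x t) ⟩
  (c₀⁻¹ * c zero) * x t                      ≡⟨ cong (_* x t) (ℚₚ.*-inverseˡ (c zero)) ⟩
  1ℚ * x t                                   ≡⟨ ℚₚ.*-identityˡ (x t) ⟩
  x t                                        ∎)
  where
  open ≡-Reasoning
  instance _ = ≢-nonZero c₀≢0
  c₀⁻¹ = 1/ c zero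
  regroup : ∀ a b c → - (a * b) * c ≡ - b * (a * c)
  regroup = solve 3 (λ a b c → (:- (a :* b)) :* c := (:- b) :* (a :* c)) refl
  a+b≡0⇒b≡-a : ∀ a b → a + b ≡ 0ℚ → b ≡ - a
  a+b≡0⇒b≡-a a b a+b≡0 = trans (solve 2 (λ a b → b := (a :+ b) :- a) refl a b)
                               (trans (cong (_- a) a+b≡0) (ℚₚ.+-identityˡ (- a)))
  cancel : ∀ i c x → - i * - (c * x) ≡ (i * c) * x
  cancel = solve 3 (λ i c x → (:- i) :* (:- (c :* x)) := (i :* c) :* x) refl

LinIndep-∷ : ∀ {p n} {x : Vector ℚ n} {u : Fin p → Vector ℚ n} → LinIndep u → ¬ InSpan u x → LinIndep (x ∷ u)
LinIndep-∷ {x = x} {u} ind x∉span c rel = coefficients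
  where
  c₀≡0 : c zero ≡ 0ℚ
  c₀≡0 with c zero ℚₚ.≟ 0ℚ
  ... | yes c₀≡0 = c₀≡0
  ... | no c₀≢0 = contradiction (InSpan-of-relation c c₀≢0 rel) x∉span
  coefficients : ∀ i → c i ≡ 0ℚ
  coefficients zero = c₀≡0
  coefficients (suc i) = ind (c ∘ suc) (λ t → trans (sym (zero-coefficient (x t) _ c₀≡0)) (rel t)) i

↑-elim : ∀ {p q} {P : Fin (p ℕ.+ q) → Set} → (∀ i → P (i ↑ˡ q)) → (∀ j → P (p ↑ʳ j)) → ∀ i → P i
↑-elim {p} {q} {P} left right i = subst P (join-splitAt p q i) (by-side (splitAt p i))
  where
  by-side : ∀ s → P (join p q s)
  by-side (inj₁ i) = left i
  by-side (inj₂ j) = right j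

LinIndep-++ : ∀ {p q n} {u : Fin p → Vector ℚ n} {v : Fin q → Vector ℚ n} → LinIndep u → LinIndep v →
  (∀ c d → (∀ t → lincomb c u t + lincomb d v t ≡ 0ℚ) → ∀ t → lincomb c u t ≡ 0ℚ) → LinIndep (u ++ v)
LinIndep-++ {p} {q} {u = u} {v} u-indep v-indep separate e rel = ↑-elim left≡0 right≡0
  where
  left right : _
  left i = e (i ↑ˡ q)
  right j = e (p ↑ʳ j)
  sum≡0 : ∀ t → lincomb left u t + lincomb right v t ≡ 0ℚ
  sum≡0 t = trans (sym (lincomb-++ e u v t)) (rel t)
  u-part≡0 = separate left right sum≡0
  left≡0 = u-indep left u-part≡0
  right≡0 = v-indep right (λ t → zero+≡0⇒≡0 (u-part≡0 t) (sum≡0 t))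

orthogonal-separate : ∀ {p q n} {u : Fin p → Vector ℚ n} {v : Fin q → Vector ℚ n} →
  (∀ i j → dot (u i) (v j) ≡ 0ℚ) →
  ∀ c d → (∀ t → lincomb c u t + lincomb d v t ≡ 0ℚ) → ∀ t → lincomb c u t ≡ 0ℚ
orthogonal-separate {u = u} {v} u⊥v c d y+z≡0 = dot-self≡0 y (begin
  sumℚ (λ t → y t * y t)                  ≡⟨ sumℚ-cong (λ t → split (y t) (z t)) ⟩
  sumℚ (λ t → y t * (y t + z t) - y t * z t) ≡⟨ sumℚ-distrib-- (λ t → y t * (y t + z t)) (λ t → y t * z t) ⟩
  sumℚ (λ t → y t * (y t + z t)) - dot y z ≡⟨ cong₂ _-_ (sumℚ-zero y·[y+z]≡0) y⊥z ⟩
  0ℚ - 0ℚ                                 ≡⟨⟩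
  0ℚ                                      ∎)
  where
  open ≡-Reasoning
  y = lincomb c u
  z = lincomb d v
  y·[y+z]≡0 : ∀ t → y t * (y t + z t) ≡ 0ℚ
  y·[y+z]≡0 t = trans (cong (y t *_) (y+z≡0 t)) (ℚₚ.*-zeroʳ (y t))
  y⊥z : dot y z ≡ 0ℚ
  y⊥z = dot-orthogonal c u z (λ i → trans (dot-lincombʳ (u i) d v)
          (sumℚ-zero (λ j → trans (cong (d j *_) (u⊥v i j)) (ℚₚ.*-zeroʳ (d j)))))
  split : ∀ a b → a * a ≡ a * (a + b) - a * b
  split = solve 2 (λ a b → a :* a := a :* (a :+ b) :- a :* b) refl

basis : ∀ {n} → Fin n → Vector ℚ n
basis i t = if ⌊ t Fin.≟ i ⌋ then 1ℚ else 0ℚ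

basis-diag : ∀ {n} (i : Fin n) → basis i i ≡ 1ℚ
basis-diag i with i Fin.≟ i
... | yes _ = refl
... | no i≢i = contradiction refl i≢i

basis-off : ∀ {n} (i t : Fin n) → i ≢ t → basis i t ≡ 0ℚ
basis-off i t i≢t with t Fin.≟ i
... | yes t≡i = contradiction (sym t≡i) i≢t
... | no _ = refl

lincomb-basis : ∀ {n} (c : Vector ℚ n) t → lincomb c basis t ≡ c t
lincomb-basis c t = begin
  sumℚ (λ i → c i * basis i t) ≡⟨ sumℚ-single _ t (λ i i≢t → trans (cong (c i *_) (basis-off i t i≢t)) (ℚₚ.*-zeroʳ (c i))) ⟩
  c t * basis t t              ≡⟨ cong (c t *_) (basis-diag t) ⟩
  c t * 1ℚ                     ≡⟨ ℚₚ.*-identityʳ (c t) ⟩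
  c t                          ∎
  where open ≡-Reasoning

LinIndep-basis : ∀ {n} → LinIndep (basis {n})
LinIndep-basis c rel i = trans (sym (lincomb-basis c i)) (rel i)

lincomb-insertAt : ∀ {m n} (d : Vector ℚ m) (k : Fin (suc m)) (γ : ℚ) (u : Fin (suc m) → Vector ℚ n) t →
  lincomb (insertAt d k γ) u t ≡ γ * u k t + lincomb d (u ∘ punchIn k) t
lincomb-insertAt d k γ u t = trans (sumℚ-remove (λ i → insertAt d k γ i * u i t) k)
  (cong₂ _+_ (cong (_* u k t) (insertAt-lookup d k γ))
             (sumℚ-cong (λ j → cong (_* u (punchIn k j) t) (insertAt-punchIn d k γ j))))

reduce : ∀ {m n} → (Fin (suc m) → Vector ℚ n) → Fin (suc m) → Vector ℚ m → Fin m → Vector ℚ n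
reduce u k β j t = u (punchIn k j) t - β j * u k t

lincomb-reduce : ∀ {m n} (u : Fin (suc m) → Vector ℚ n) k (β d : Vector ℚ m) t →
  lincomb d (reduce u k β) t ≡ lincomb (insertAt d k (- sumℚ (λ j → d j * β j))) u t
lincomb-reduce u k β d t = begin
  sumℚ (λ j → d j * (u (punchIn k j) t - β j * u k t))            ≡⟨ sumℚ-cong (λ j → distrib (d j) (u (punchIn k j) t) (β j)) ⟩
  sumℚ (λ j → d j * u (punchIn k j) t - u k t * (d j * β j))      ≡⟨ sumℚ-linear _ (λ j → d j * β j) (u k t) ⟩
  lincomb d (u ∘ punchIn k) t - u k t * sumℚ (λ j → d j * β j)   ≡⟨ regroup (lincomb d (u ∘ punchIn k) t) (u k t) _ ⟩
  - sumℚ (λ j → d j * β j) * u k t + lincomb d (u ∘ punchIn k) t ≡⟨ lincomb-insertAt d k _ u t ⟨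
  lincomb (insertAt d k (- sumℚ (λ j → d j * β j))) u t           ∎
  where
  open ≡-Reasoning
  distrib : ∀ d a b → d * (a - b * u k t) ≡ d * a - u k t * (d * b)
  distrib d a b = solve 4 (λ d a b x → d :* (a :- b :* x) := d :* a :- x :* (d :* b)) refl d a b (u k t)
  regroup : ∀ l x s → l - x * s ≡ - s * x + l
  regroup = solve 3 (λ l x s → l :- x :* s := (:- s) :* x :+ l) refl

LinIndep-reduce : ∀ {m n} (u : Fin (suc m) → Vector ℚ n) k (β : Vector ℚ m) → LinIndep u → LinIndep (reduce u k β)
LinIndep-reduce u k β ind d rel j = trans (sym (insertAt-punchIn d k γ j))
  (ind (insertAt d k γ) (λ t → trans (sym (lincomb-reduce u k β d t)) (rel t)) (punchIn k j))
  where γ = - sumℚ (λ j → d j * β j)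

InSpan-tail : ∀ {q n} (w : Fin (suc q) → Vector ℚ n) {x : Vector ℚ n} →
  ((c , _) : InSpan w x) → c zero ≡ 0ℚ → InSpan (w ∘ suc) x
InSpan-tail w (c , x≡) c₀≡0 = c ∘ suc , λ t → trans (x≡ t) (zero-coefficient (w zero t) _ c₀≡0)

module _ {p q n} (u : Fin (suc p) → Vector ℚ n) (w : Fin (suc q) → Vector ℚ n)
         (span : ∀ i → InSpan w (u i)) (k : Fin (suc p)) (pivot≢0 : proj₁ (span k) zero ≢ 0ℚ) where

  private
    instance _ = ≢-nonZero pivot≢0
    coef : Fin (suc p) → Vector ℚ (suc q)
    coef i = proj₁ (span i)

  pivot-ratios : Vector ℚ p
  pivot-ratios j = coef (punchIn k j) zero * 1/ coef k zero

  reduce-InSpan : ∀ j → InSpan (w ∘ suc) (reduce u k pivot-ratios j)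
  reduce-InSpan j = InSpan-tail w ((λ i → coef (punchIn k j) i - β * coef k i) , λ t → begin
    u (punchIn k j) t - β * u k t                                    ≡⟨ cong₂ (λ a b → a - β * b) (proj₂ (span _) t) (proj₂ (span k) t) ⟩
    lincomb (coef (punchIn k j)) w t - β * lincomb (coef k) w t       ≡⟨ lincomb-linear (coef (punchIn k j)) (coef k) β w t ⟨
    lincomb (λ i → coef (punchIn k j) i - β * coef k i) w t          ∎)
    (ratio-cancel (coef (punchIn k j) zero) (coef k zero))
    where
    open ≡-Reasoning
    β = pivot-ratios j

-- Induction on q: if some u k uses w zero, eliminating w zero by pivoting on u k costs one vector.
steinitz : ∀ {p q n} {u : Fin p → Vector ℚ n} (w : Fin q → Vector ℚ n) →
  LinIndep u → (∀ i → InSpan w (u i)) → p ≤ q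
steinitz {zero} w ind span = z≤n
steinitz {suc p} {zero} w ind span =
  contradiction (ind (λ _ → 1ℚ) (λ t → sumℚ-zero (λ i → trans (ℚₚ.*-identityˡ _) (proj₂ (span i) t))) zero) λ ()
steinitz {suc p} {suc q} {u = u} w ind span with all? (λ i → proj₁ (span i) zero ℚₚ.≟ 0ℚ)
... | yes unused = ℕₚ.m≤n⇒m≤1+n (steinitz (w ∘ suc) ind (λ i → InSpan-tail w (span i) (unused i)))
... | no used with ¬∀⟶∃¬ _ _ (λ i → proj₁ (span i) zero ℚₚ.≟ 0ℚ) used
...   | k , pivot≢0 =
  s≤s (steinitz (w ∘ suc) (LinIndep-reduce u k (pivot-ratios u w span k pivot≢0) ind)
                          (reduce-InSpan u w span k pivot≢0))

LinIndep⇒≤ : ∀ {p n} {u : Fin p → Vector ℚ n} → LinIndep u → p ≤ n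
LinIndep⇒≤ {u = u} ind = steinitz basis ind (λ i → u i , λ t → sym (lincomb-basis (u i) t))

OrthogonalComplement : ∀ {r n} → (Fin r → Vector ℚ n) → Set
OrthogonalComplement {r} {n} w = Σ ℕ λ m → Σ (Fin m → Vector ℚ n) λ u →
  LinIndep u × (∀ i j → dot (w i) (u j) ≡ 0ℚ) × n ≤ m ℕ.+ r

module _ {r m n} (w : Fin (suc r) → Vector ℚ n) (u : Fin (suc m) → Vector ℚ n) (k : Fin (suc m))
         (pivot≢0 : dot (w zero) (u k) ≢ 0ℚ) where

  private
    instance _ = ≢-nonZero pivot≢0
    α : Vector ℚ (suc m)
    α j = dot (w zero) (u j)

  orthogonal-ratios : Vector ℚ m
  orthogonal-ratios j = α (punchIn k j) * 1/ α k

  reduce-orthogonal : (∀ i j → dot (w (suc i)) (u j) ≡ 0ℚ) →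
    ∀ i j → dot (w i) (reduce u k orthogonal-ratios j) ≡ 0ℚ
  reduce-orthogonal _ zero j =
    trans (dot-linearʳ (w zero) (u (punchIn k j)) (u k) (orthogonal-ratios j)) (ratio-cancel (α (punchIn k j)) (α k))
  reduce-orthogonal w⊥u (suc i) j = begin
    dot (w (suc i)) (reduce u k orthogonal-ratios j)                       ≡⟨ dot-linearʳ (w (suc i)) (u (punchIn k j)) (u k) β ⟩
    dot (w (suc i)) (u (punchIn k j)) - β * dot (w (suc i)) (u k)          ≡⟨ cong₂ (λ a b → a - β * b) (w⊥u i (punchIn k j)) (w⊥u i k) ⟩
    0ℚ - β * 0ℚ                                                           ≡⟨ solve 1 (λ b → con 0ℚ :- b :* con 0ℚ := con 0ℚ) refl β ⟩
    0ℚ                                                                    ∎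
    where
    open ≡-Reasoning
    β = orthogonal-ratios j

orthogonal-complement : ∀ {r n} (w : Fin r → Vector ℚ n) → OrthogonalComplement w
orthogonal-complement {zero} {n} w = n , basis , LinIndep-basis , (λ ()) , ℕₚ.≤-reflexive (sym (ℕₚ.+-identityʳ n))
orthogonal-complement {suc r} w with orthogonal-complement (w ∘ suc)
... | m , u , u-indep , w⊥u , n≤m+r with all? (λ j → dot (w zero) (u j) ℚₚ.≟ 0ℚ)
...   | yes w₀⊥u =
  m , u , u-indep , (λ { zero → w₀⊥u ; (suc i) → w⊥u i }) , ℕₚ.≤-trans n≤m+r (ℕₚ.+-monoʳ-≤ m (ℕₚ.n≤1+n r))
...   | no ¬w₀⊥u with ¬∀⟶∃¬ _ _ (λ j → dot (w zero) (u j) ℚₚ.≟ 0ℚ) ¬w₀⊥u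
orthogonal-complement {suc r} w | suc m , u , u-indep , w⊥u , n≤m+r | no _ | k , pivot≢0 =
  m , reduce u k β , LinIndep-reduce u k β u-indep , reduce-orthogonal w u k pivot≢0 w⊥u ,
  ℕₚ.≤-trans n≤m+r (ℕₚ.≤-reflexive (sym (ℕₚ.+-suc m r)))
  where β = orthogonal-ratios w u k pivot≢0

¬¬-∀-Fin : ∀ {n} {P : Fin n → Set} → (∀ i → ¬ ¬ P i) → ¬ ¬ (∀ i → P i)
¬¬-∀-Fin {zero} _ ¬∀ = ¬∀ λ ()
¬¬-∀-Fin {suc n} {P} ¬¬P ¬∀ = ¬¬P zero λ P₀ → ¬¬-∀-Fin (¬¬P ∘ suc) λ P₊ → ¬∀ λ where
  zero → P₀
  (suc i) → P₊ i

¬¬-last : ∀ (P : ℕ → Set) {N} → P 0 → ¬ P N → ¬ ¬ (∃ λ m → P m × ¬ P (suc m))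
¬¬-last P {N} P₀ ¬P_N no-last = ¬¬P N ¬P_N
  where
  ¬¬P : ∀ m → ¬ ¬ P m
  ¬¬P zero ¬P₀ = ¬P₀ P₀
  ¬¬P (suc m) ¬P₁₊ₘ = ¬¬P m λ Pm → no-last (m , Pm , ¬P₁₊ₘ)

-- Rank and nullity

maximal-rows⇒¬¬InSpan : ∀ {p n} {A : Matrix n} {ρ : Fin p → Fin n} {x : Fin n} →
  LinIndep (A ∘ ρ) → ¬ LinIndep (A ∘ (x ∷ ρ)) → ¬ ¬ InSpan (A ∘ ρ) (A x)
maximal-rows⇒¬¬InSpan {A = A} {ρ} {x} ρ-indep dep x∉span =
  dep (LinIndep-resp {u = A x ∷ (A ∘ ρ)} {A ∘ (x ∷ ρ)} (λ { zero t → refl ; (suc i) t → refl })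
                     (LinIndep-∷ ρ-indep x∉span))

module _ {n : ℕ} {A : Matrix n} where

  IsRank-maximal : ∀ {r m} → IsRank A r → (ρ : Fin m → Fin n) → LinIndep (A ∘ ρ) → m ≤ r
  IsRank-maximal {r} {m} (_ , no-larger) ρ ρ-indep with m ℕ.≤? r
  ... | yes m≤r = m≤r
  ... | no m≰r = contradiction (LinIndep-inject≤ (A ∘ ρ) r<m ρ-indep) (no-larger (λ i → ρ (inject≤ i r<m)))
    where r<m = ℕₚ.≰⇒> m≰r

  IsNullity-maximal : ∀ {k m} → IsNullity A k → (u : Fin m → Vector ℚ n) →
    (∀ j → InKernel A (u j)) → LinIndep u → m ≤ k
  IsNullity-maximal {k} {m} (_ , no-larger) u u-ker u-indep with m ℕ.≤? k
  ... | yes m≤k = m≤k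
  ... | no m≰k = contradiction (LinIndep-inject≤ u k<m u-indep) (no-larger (λ i → u (inject≤ i k<m)) (λ i → u-ker _))
    where k<m = ℕₚ.≰⇒> m≰k

  IsRank-spans : ∀ {r} (((ρ , _) , _) : IsRank A r) → ¬ ¬ (∀ x → InSpan (A ∘ ρ) (A x))
  IsRank-spans ((ρ , ρ-indep) , no-larger) = ¬¬-∀-Fin λ x → maximal-rows⇒¬¬InSpan {A = A} ρ-indep (no-larger (x ∷ ρ))

  rank+nullity≤n : ∀ {r k} → IsRank A r → IsNullity A k → r ℕ.+ k ≤ n
  rank+nullity≤n ((ρ , ρ-indep) , _) ((v , v-ker , v-indep) , _) =
    LinIndep⇒≤ (LinIndep-++ ρ-indep v-indep (orthogonal-separate (λ i j → v-ker j (ρ i))))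

  n≤rank+nullity : ∀ {r k} → IsRank A r → IsNullity A k → ¬ ¬ (n ≤ r ℕ.+ k)
  n≤rank+nullity {r} {k} isRank@((ρ , _) , _) isNullity = do
    spans ← IsRank-spans isRank
    let (m , u , u-indep , ρ⊥u , n≤m+r) = orthogonal-complement (A ∘ ρ)
        u-ker j x = InSpan-orthogonal (A ∘ ρ) (spans x) (λ i → ρ⊥u i j)
        m≤k = IsNullity-maximal isNullity u u-ker u-indep
    pure (ℕₚ.≤-trans n≤m+r (ℕₚ.≤-trans (ℕₚ.+-monoˡ-≤ r m≤k) (ℕₚ.≤-reflexive (ℕₚ.+-comm k r))))

  rank+nullity≡n : ∀ {r k} → IsRank A r → IsNullity A k → ¬ ¬ (r ℕ.+ k ≡ n)
  rank+nullity≡n isRank isNullity = do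
    n≤r+k ← n≤rank+nullity isRank isNullity
    pure (ℕₚ.≤-antisym (rank+nullity≤n isRank isNullity) n≤r+k)

rank-perturbation-≤ : ∀ {n q r₁ r₂} {A B : Matrix n} → IsRank A r₁ → IsRank B r₂ →
  (g : Fin q → Vector ℚ n) (e : Fin n → Vector ℚ q) → (∀ x t → B x t ≡ A x t + lincomb (e x) g t) →
  ¬ ¬ (r₂ ≤ r₁ ℕ.+ q)
rank-perturbation-≤ {A = A} {B} isRankA@((ρ₁ , _) , _) ((ρ₂ , ρ₂-indep) , _) g e B≡A+ = do
  spans ← IsRank-spans {A = A} isRankA
  pure (steinitz ((A ∘ ρ₁) ++ g) ρ₂-indep λ i →
    InSpan-resp (λ t → sym (B≡A+ (ρ₂ i) t)) (InSpan-++ (spans (ρ₂ i)) (e (ρ₂ i) , λ t → refl)))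

rank-perturbation : ∀ {n q r₁ r₂} {A B : Matrix n} → IsRank A r₁ → IsRank B r₂ →
  (g : Fin q → Vector ℚ n) (e : Fin n → Vector ℚ q) → (∀ x t → B x t ≡ A x t + lincomb (e x) g t) →
  ¬ ¬ (r₂ ≤ r₁ ℕ.+ q × r₁ ≤ r₂ ℕ.+ q)
rank-perturbation {A = A} {B} isRankA isRankB g e B≡A+ = do
  r₂≤r₁+q ← rank-perturbation-≤ {A = A} {B} isRankA isRankB g e B≡A+
  r₁≤r₂+q ← rank-perturbation-≤ {A = B} {A} isRankB isRankA g (λ x i → - e x i) A≡B-
  pure (r₂≤r₁+q , r₁≤r₂+q)
  where
  A≡B- : ∀ x t → A x t ≡ B x t + lincomb (λ i → - e x i) g t
  A≡B- x t = begin
    A x t                                           ≡⟨ solve 2 (λ a d → a := (a :+ d) :+ (:- d)) refl (A x t) (lincomb (e x) g t) ⟩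
    (A x t + lincomb (e x) g t) - lincomb (e x) g t ≡⟨ cong₂ _+_ (B≡A+ x t) (lincomb-neg (e x) g t) ⟨
    B x t + lincomb (λ i → - e x i) g t             ∎
    where open ≡-Reasoning

-- Even rank of bipartite symmetric matrices

∘-++ : ∀ {A B : Set} {p q} (f : A → B) (xs : Vector A p) (ys : Vector A q) i → f ((xs ++ ys) i) ≡ ((f ∘ xs) ++ (f ∘ ys)) i
∘-++ {p = p} f xs ys i = [,]-∘ f (splitAt p i)

-- For symmetric A, dot (A u) y is the u-th entry of lincomb y A, so A y = 0 makes y orthogonal to every row.
symmetric-rowspace∩kernel : ∀ {n p} {A : Matrix n} → (∀ x y → A x y ≡ A y x) →
  (ρ : Fin p → Fin n) (c : Vector ℚ p) → (∀ t → lincomb (lincomb c (A ∘ ρ)) A t ≡ 0ℚ) →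
  ∀ t → lincomb c (A ∘ ρ) t ≡ 0ℚ
symmetric-rowspace∩kernel {A = A} A-sym ρ c Ay≡0 = dot-self≡0 y (dot-orthogonal c (A ∘ ρ) y (row⊥y ∘ ρ))
  where
  y = lincomb c (A ∘ ρ)
  row⊥y : ∀ u → dot (A u) y ≡ 0ℚ
  row⊥y u = trans (sumℚ-cong (λ t → trans (ℚₚ.*-comm (A u t) (y t)) (cong (y t *_) (A-sym u t)))) (Ay≡0 u)

module Bipartite {n : ℕ} (A : Matrix n) (colour : Fin n → Bool)
  (A-sym : ∀ x y → A x y ≡ A y x) (A-monochrome : ∀ x y → colour x ≡ colour y → A x y ≡ 0ℚ) where

  IndependentRows : Bool → ℕ → Set
  IndependentRows b p = Σ (Fin p → Fin n) λ ρ → (∀ i → colour (ρ i) ≡ b) × LinIndep (A ∘ ρ)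

  RowBasis : Bool → Set
  RowBasis b = Σ ℕ λ p → Σ (Fin p → Fin n) λ ρ → (∀ i → colour (ρ i) ≡ b) × LinIndep (A ∘ ρ) ×
    (∀ x → colour x ≡ b → InSpan (A ∘ ρ) (A x))

  rowBasis : ∀ b → ¬ ¬ RowBasis b
  rowBasis b = do
    (p , (ρ , ρ-colour , ρ-indep) , maximal) ←
      ¬¬-last (IndependentRows b) ((λ ()) , (λ ()) , λ _ _ ()) (λ (ρ , _ , ind) → ℕₚ.1+n≰n (LinIndep⇒≤ {u = A ∘ ρ} ind))
    spans ← ¬¬-∀-Fin λ x → spanned ρ ρ-colour ρ-indep maximal x (colour x Bool.≟ b)
    pure (p , ρ , ρ-colour , ρ-indep , spans)
    where
    spanned : ∀ {p} (ρ : Fin p → Fin n) → (∀ i → colour (ρ i) ≡ b) → LinIndep (A ∘ ρ) →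
      ¬ IndependentRows b (suc p) → ∀ x → Dec (colour x ≡ b) → ¬ ¬ (colour x ≡ b → InSpan (A ∘ ρ) (A x))
    spanned ρ ρ-colour ρ-indep maximal x (no x≢b) = pure (λ x≡b → contradiction x≡b x≢b)
    spanned ρ ρ-colour ρ-indep maximal x (yes x≡b) = do
      x∈span ← maximal-rows⇒¬¬InSpan {A = A} {ρ} {x} ρ-indep λ ind →
        maximal (x ∷ ρ , (λ { zero → x≡b ; (suc i) → ρ-colour i }) , ind)
      pure (λ _ → x∈span)

  lincomb-off-colour : ∀ {b p} (ρ : Fin p → Fin n) → (∀ i → colour (ρ i) ≡ b) →
    ∀ c t → colour t ≡ b → lincomb c (A ∘ ρ) t ≡ 0ℚ
  lincomb-off-colour ρ ρ-colour c t t≡b =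
    sumℚ-zero (λ i → trans (cong (c i *_) (A-monochrome (ρ i) t (trans (ρ-colour i) (sym t≡b)))) (ℚₚ.*-zeroʳ (c i)))

  -- Multiplication by A maps the rows of X injectively into the span of Y, as they vanish on colour b.
  RowBasis-≤ : ∀ {b} (X : RowBasis b) (Y : RowBasis (not b)) → proj₁ X ≤ proj₁ Y
  RowBasis-≤ {b} (p , ρX , X-colour , X-indep , _) (q , ρY , Y-colour , _ , Y-spans) =
    steinitz (A ∘ ρY) z-indep z-span
    where
    z : Fin p → Vector ℚ n
    z i = lincomb (A (ρX i)) A
    coef : ∀ v → Dec (colour v ≡ not b) → Vector ℚ q
    coef v (yes v≡¬b) = proj₁ (Y-spans v v≡¬b)
    coef v (no _) = λ _ → 0ℚ
    through-Y : ∀ i v t (d : Dec (colour v ≡ not b)) →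
      A (ρX i) v * A v t ≡ A (ρX i) v * lincomb (coef v d) (A ∘ ρY) t
    through-Y i v t (yes v≡¬b) = cong (A (ρX i) v *_) (proj₂ (Y-spans v v≡¬b) t)
    through-Y i v t (no v≢¬b) = zero-factor (A v t) (lincomb (λ _ → 0ℚ) (A ∘ ρY) t)
      (A-monochrome (ρX i) v (trans (X-colour i) (sym (trans (¬-not v≢¬b) (not-involutive b)))))
    Y-coefficients : Fin n → Vector ℚ q
    Y-coefficients v = coef v (colour v Bool.≟ not b)
    z-span : ∀ i → InSpan (A ∘ ρY) (z i)
    z-span i = (λ j → sumℚ (λ v → A (ρX i) v * Y-coefficients v j)) , λ t →
      trans (sumℚ-cong (λ v → through-Y i v t (colour v Bool.≟ not b)))
            (lincomb-lincomb (A (ρX i)) Y-coefficients (A ∘ ρY) t)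
    z-indep : LinIndep z
    z-indep c rel = X-indep c (symmetric-rowspace∩kernel A-sym ρX c λ t →
      trans (sym (lincomb-lincomb c (A ∘ ρX) A t)) (rel t))

  RowBasis-independent : (X : RowBasis true) (Y : RowBasis false) →
    LinIndep ((A ∘ proj₁ (proj₂ X)) ++ (A ∘ proj₁ (proj₂ Y)))
  RowBasis-independent (p , ρX , X-colour , X-indep , _) (q , ρY , Y-colour , Y-indep , _) =
    LinIndep-++ X-indep Y-indep separate
    where
    separate : ∀ c d → (∀ t → lincomb c (A ∘ ρX) t + lincomb d (A ∘ ρY) t ≡ 0ℚ) →
      ∀ t → lincomb c (A ∘ ρX) t ≡ 0ℚ
    separate c d y+z≡0 t with colour t Bool.≟ true
    ... | yes t≡true = lincomb-off-colour ρX X-colour c t t≡true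
    ... | no t≢true = begin
      lincomb c (A ∘ ρX) t                           ≡⟨ ℚₚ.+-identityʳ _ ⟨
      lincomb c (A ∘ ρX) t + 0ℚ                      ≡⟨ cong (lincomb c (A ∘ ρX) t +_) (lincomb-off-colour ρY Y-colour d t (¬-not t≢true)) ⟨
      lincomb c (A ∘ ρX) t + lincomb d (A ∘ ρY) t    ≡⟨ y+z≡0 t ⟩
      0ℚ                                             ∎
      where open ≡-Reasoning

  RowBasis-spans : (X : RowBasis true) (Y : RowBasis false) →
    ∀ x → InSpan ((A ∘ proj₁ (proj₂ X)) ++ (A ∘ proj₁ (proj₂ Y))) (A x)
  RowBasis-spans (_ , ρX , _ , _ , X-spans) (_ , ρY , _ , _ , Y-spans) x with colour x in eq
  ... | true = InSpan-++ˡ (A ∘ ρY) (X-spans x eq)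
  ... | false = InSpan-++ʳ (A ∘ ρX) (Y-spans x eq)

  even-rank : ∀ {r} → IsRank A r → ¬ ¬ (∃ λ p → r ≡ p ℕ.+ p)
  even-rank {r} isRank@((ρ , ρ-indep) , _) = do
    X@(p , ρX , _) ← rowBasis true
    Y@(q , ρY , _) ← rowBasis false
    let p≤q = RowBasis-≤ X Y
        q≤p = RowBasis-≤ Y X
        r≤p+q = steinitz ((A ∘ ρX) ++ (A ∘ ρY)) ρ-indep (RowBasis-spans X Y ∘ ρ)
        p+q≤r = IsRank-maximal {A = A} isRank (ρX ++ ρY)
                  (LinIndep-resp (λ i t → cong (_$ t) (sym (∘-++ A ρX ρY i))) (RowBasis-independent X Y))
    pure (p , ℕₚ.≤-antisym (ℕₚ.≤-trans r≤p+q (ℕₚ.+-monoʳ-≤ p q≤p)) (ℕₚ.≤-trans (ℕₚ.+-monoʳ-≤ p p≤q) p+q≤r))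

-- A 2-switch is a perturbation of rank two

adjacent⇒≢ : ∀ {n} {G : Adj n} → Simple G → ∀ {u v} → G u v ≡ true → u ≢ v
adjacent⇒≢ (_ , G-loopless) {u} uv refl = contradiction (trans (sym uv) (G-loopless u)) λ ()

≢⇒⌊≟⌋≡false : ∀ {n} {x y : Fin n} → x ≢ y → ⌊ x Fin.≟ y ⌋ ≡ false
≢⇒⌊≟⌋≡false {x = x} {y} x≢y with x Fin.≟ y
... | yes x≡y = contradiction x≡y x≢y
... | no _ = refl

switch-nontrivial : ∀ {n} {F : Adj n} {a b c d} → Nontrivial F a b c d → switch F a b c d ≡ switchRaw F a b c d
switch-nontrivial {F = F} {a} {b} {c} {d} (ab , cd , a≢c , a≢d , b≢c , b≢d , ac , bd) =
  cong (λ β → if β then switchRaw F a b c d else F) condition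
  where
  condition : F a b ∧ F c d ∧ not ⌊ a Fin.≟ c ⌋ ∧ not ⌊ a Fin.≟ d ⌋ ∧ not ⌊ b Fin.≟ c ⌋ ∧ not ⌊ b Fin.≟ d ⌋
              ∧ not (F a c) ∧ not (F b d) ≡ true
  condition rewrite ab | cd | ≢⇒⌊≟⌋≡false a≢c | ≢⇒⌊≟⌋≡false a≢d | ≢⇒⌊≟⌋≡false b≢c | ≢⇒⌊≟⌋≡false b≢d | ac | bd = refl

sameEdge-true : ∀ {n} (x t u v : Fin n) → sameEdge x t u v ≡ true → (x ≡ u × t ≡ v) ⊎ (x ≡ v × t ≡ u)
sameEdge-true x t u v eq with x Fin.≟ u | t Fin.≟ v | x Fin.≟ v | t Fin.≟ u
... | yes x≡u | yes t≡v | _ | _ = inj₁ (x≡u , t≡v)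
... | _ | _ | yes x≡v | yes t≡u = inj₂ (x≡v , t≡u)
sameEdge-true x t u v () | no _ | _ | no _ | _
sameEdge-true x t u v () | no _ | _ | yes _ | no _
sameEdge-true x t u v () | yes _ | no _ | no _ | _
sameEdge-true x t u v () | yes _ | no _ | yes _ | no _

module _ {n : ℕ} {G : Adj n} (G-sym : ∀ i j → G i j ≡ G j i) where

  sameEdge-adj : ∀ {x t u v β} → sameEdge x t u v ≡ true → G u v ≡ β → G x t ≡ β
  sameEdge-adj {x} {t} {u} {v} same uv with sameEdge-true x t u v same
  ... | inj₁ (refl , refl) = uv
  ... | inj₂ (refl , refl) = trans (G-sym v u) uv

  either-sameEdge-adj : ∀ {x t u v u′ v′ β} → G u v ≡ β → G u′ v′ ≡ β →
    sameEdge x t u v ∨ sameEdge x t u′ v′ ≡ true → G x t ≡ β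
  either-sameEdge-adj {x} {t} {u} {v} uv u′v′ same with sameEdge x t u v in eq
  ... | true = sameEdge-adj eq uv
  ... | false = sameEdge-adj same u′v′

ι : Bool → ℚ
ι b = if b then 1ℚ else 0ℚ

data Spot : Bool → Bool → Bool → Bool → Set where
  at-a : Spot true false false false
  at-b : Spot false true false false
  at-c : Spot false false true false
  at-d : Spot false false false true
  away : Spot false false false false

spot : ∀ {n} {a b c d : Fin n} → a ≢ b → a ≢ c → a ≢ d → b ≢ c → b ≢ d → c ≢ d →
  ∀ x → Spot ⌊ x Fin.≟ a ⌋ ⌊ x Fin.≟ b ⌋ ⌊ x Fin.≟ c ⌋ ⌊ x Fin.≟ d ⌋
spot {a = a} {b} {c} {d} a≢b a≢c a≢d b≢c b≢d c≢d x with x Fin.≟ a | x Fin.≟ b | x Fin.≟ c | x Fin.≟ d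
... | yes refl | yes refl | _ | _ = contradiction refl a≢b
... | yes refl | no _ | yes refl | _ = contradiction refl a≢c
... | yes refl | no _ | no _ | yes refl = contradiction refl a≢d
... | yes _ | no _ | no _ | no _ = at-a
... | no _ | yes refl | yes refl | _ = contradiction refl b≢c
... | no _ | yes refl | no _ | yes refl = contradiction refl b≢d
... | no _ | yes _ | no _ | no _ = at-b
... | no _ | no _ | yes refl | yes refl = contradiction refl c≢d
... | no _ | no _ | yes _ | no _ = at-c
... | no _ | no _ | no _ | yes _ = at-d
... | no _ | no _ | no _ | no _ = away

-- The arguments are ⌊ x ≟ a ⌋ … ⌊ x ≟ d ⌋ and ⌊ t ≟ a ⌋ … ⌊ t ≟ d ⌋; the value is the change of the (x , t) entry.
switch-Δ : (xa xb xc xd ta tb tc td : Bool) → ℚ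
switch-Δ xa xb xc xd ta tb tc td =
  if ((xa ∧ tb) ∨ (xb ∧ ta)) ∨ ((xc ∧ td) ∨ (xd ∧ tc)) then - 1ℚ
  else if ((xa ∧ tc) ∨ (xc ∧ ta)) ∨ ((xb ∧ td) ∨ (xd ∧ tb)) then 1ℚ else 0ℚ

switch-Δ-rank-two : ∀ {xa xb xc xd ta tb tc td} → Spot xa xb xc xd → Spot ta tb tc td →
  switch-Δ xa xb xc xd ta tb tc td ≡ (ι xa - ι xd) * (ι tc - ι tb) + ((ι xb - ι xc) * (ι td - ι ta) + 0ℚ)
switch-Δ-rank-two at-a at-a = refl
switch-Δ-rank-two at-a at-b = refl
switch-Δ-rank-two at-a at-c = refl
switch-Δ-rank-two at-a at-d = refl
switch-Δ-rank-two at-a away = refl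
switch-Δ-rank-two at-b at-a = refl
switch-Δ-rank-two at-b at-b = refl
switch-Δ-rank-two at-b at-c = refl
switch-Δ-rank-two at-b at-d = refl
switch-Δ-rank-two at-b away = refl
switch-Δ-rank-two at-c at-a = refl
switch-Δ-rank-two at-c at-b = refl
switch-Δ-rank-two at-c at-c = refl
switch-Δ-rank-two at-c at-d = refl
switch-Δ-rank-two at-c away = refl
switch-Δ-rank-two at-d at-a = refl
switch-Δ-rank-two at-d at-b = refl
switch-Δ-rank-two at-d at-c = refl
switch-Δ-rank-two at-d at-d = refl
switch-Δ-rank-two at-d away = refl
switch-Δ-rank-two away at-a = refl
switch-Δ-rank-two away at-b = refl
switch-Δ-rank-two away at-c = refl
switch-Δ-rank-two away at-d = refl
switch-Δ-rank-two away away = refl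

ι-override : ∀ (removed added e : Bool) → (removed ≡ true → e ≡ true) → (added ≡ true → e ≡ false) →
  ι (if removed then false else if added then true else e) ≡ ι e + (if removed then - 1ℚ else if added then 1ℚ else 0ℚ)
ι-override true added e e-edge _ rewrite e-edge refl = refl
ι-override false true e _ e-non-edge rewrite e-non-edge refl = refl
ι-override false false false _ _ = refl
ι-override false false true _ _ = refl

-- switchRaw G = G + (e_a − e_d)(e_c − e_b)ᵀ + (e_b − e_c)(e_d − e_a)ᵀ, a perturbation of rank at most two.
switch-directions : ∀ {n} (a b c d : Fin n) → Fin 2 → Vector ℚ n
switch-directions a b c d = (λ t → basis c t - basis b t) ∷ (λ t → basis d t - basis a t) ∷ []

switch-coefficients : ∀ {n} (a b c d : Fin n) → Fin n → Vector ℚ 2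
switch-coefficients a b c d x = (basis a x - basis d x) ∷ (basis b x - basis c x) ∷ []

adjMatrix-switch : ∀ {n} {F : Adj n} {a b c d} → Simple F → Nontrivial F a b c d → ∀ x t →
  adjMatrix (switch F a b c d) x t ≡
  adjMatrix F x t + lincomb (switch-coefficients a b c d x) (switch-directions a b c d) t
adjMatrix-switch {F = F} {a} {b} {c} {d} simple@(F-sym , _)
                 nontrivial@(ab , cd , a≢c , a≢d , b≢c , b≢d , ac , bd) x t =
  trans (cong (λ G → adjMatrix G x t) (switch-nontrivial nontrivial))
  (trans (ι-override _ _ (F x t) (either-sameEdge-adj F-sym ab cd) (either-sameEdge-adj F-sym ac bd))
         (cong (adjMatrix F x t +_) (switch-Δ-rank-two (spot′ x) (spot′ t))))
  where spot′ = spot (adjacent⇒≢ simple ab) a≢c a≢d b≢c b≢d (adjacent⇒≢ simple cd)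

-- Forests are bipartite

Path : ∀ {n} → Adj n → ℕ → Set
Path {n} G m = Σ (Fin (suc m) → Fin n) λ v →
  Injective _≡_ _≡_ v × (∀ (i : Fin m) → G (v (inject₁ i)) (v (suc i)) ≡ true)

Leaf : ∀ {n} → Adj n → Fin n → Set
Leaf G ℓ = ∀ y z → G ℓ y ≡ true → G ℓ z ≡ true → y ≡ z

module _ {n : ℕ} {G : Adj n} (simple : Simple G) where

  private
    G-sym : ∀ i j → G i j ≡ G j i
    G-sym = proj₁ simple

  Path-take : ∀ {j m} → j ≤ m → Path G m → Path G j
  Path-take {j} j≤m (v , v-injective , v-adjacent) = u , u-injective , u-adjacent
    where
    u : Fin (suc j) → Fin n
    u i = v (inject≤ i (s≤s j≤m))
    u-injective : Injective _≡_ _≡_ u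
    u-injective eq = inject≤-injective _ _ _ _ (v-injective eq)
    inject₁-inject≤ : ∀ i → inject₁ (inject≤ i j≤m) ≡ inject≤ (inject₁ i) (s≤s j≤m)
    inject₁-inject≤ i = toℕ-injective (begin
      toℕ (inject₁ (inject≤ i j≤m))         ≡⟨ toℕ-inject₁ _ ⟩
      toℕ (inject≤ i j≤m)                   ≡⟨ toℕ-inject≤ i j≤m ⟩
      toℕ i                                 ≡⟨ toℕ-inject₁ i ⟨
      toℕ (inject₁ i)                       ≡⟨ toℕ-inject≤ (inject₁ i) (s≤s j≤m) ⟨
      toℕ (inject≤ (inject₁ i) (s≤s j≤m))  ∎)
      where open ≡-Reasoning
    u-adjacent : ∀ (i : Fin j) → G (u (inject₁ i)) (u (suc i)) ≡ true
    u-adjacent i = subst (λ k → G (v k) (u (suc i)) ≡ true) (inject₁-inject≤ i) (v-adjacent (inject≤ i j≤m))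

  path-start-neighbour : ¬ Cycle G → ∀ {m} ((v , _) : Path G m) k → G (v zero) (v k) ≡ true → toℕ k ≡ 1
  path-start-neighbour _ (v , _) zero v₀v₀ = contradiction refl (adjacent⇒≢ simple v₀v₀)
  path-start-neighbour _ _ (suc zero) _ = refl
  path-start-neighbour acyclic {suc m} p@(v , _) (suc (suc k)) v₀vₖ =
    ⊥-elim (acyclic (toℕ k , u , u-injective , u-adjacent , closing))
    where
    j≤m = toℕ<n (suc k)
    prefix = Path-take j≤m p
    u = proj₁ prefix
    u-injective : Injective _≡_ _≡_ u
    u-injective = proj₁ (proj₂ prefix)
    u-adjacent = proj₂ (proj₂ prefix)
    last≡k : inject≤ (fromℕ (suc (suc (toℕ k)))) (s≤s j≤m) ≡ suc (suc k)
    last≡k = toℕ-injective (trans (toℕ-inject≤ _ (s≤s j≤m)) (toℕ-fromℕ _))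
    closing : G (u (fromℕ (suc (suc (toℕ k))))) (u zero) ≡ true
    closing = subst (λ i → G (v i) (v zero) ≡ true) (sym last≡k) (trans (G-sym _ _) v₀vₖ)

  maximal-path-neighbour : ∀ {m} ((v , _) : Path G m) → ¬ Path G (suc m) →
    ∀ {y} → G (v zero) y ≡ true → ∃ λ j → v j ≡ y
  maximal-path-neighbour (v , v-injective , v-adjacent) maximal {y} v₀y with any? (λ j → v j Fin.≟ y)
  ... | yes on-path = on-path
  ... | no off-path = ⊥-elim (maximal (y ∷ v , extended-injective , extended-adjacent))
    where
    extended-injective : Injective _≡_ _≡_ (y ∷ v)
    extended-injective {zero} {zero} _ = refl
    extended-injective {zero} {suc j} y≡vj = contradiction (j , sym y≡vj) off-path
    extended-injective {suc i} {zero} vi≡y = contradiction (i , vi≡y) off-path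
    extended-injective {suc i} {suc j} vi≡vj = cong suc (v-injective vi≡vj)
    extended-adjacent : ∀ i → G ((y ∷ v) (inject₁ i)) ((y ∷ v) (suc i)) ≡ true
    extended-adjacent zero = trans (G-sym y (v zero)) v₀y
    extended-adjacent (suc i) = v-adjacent i

  maximal-path-start-leaf : ¬ Cycle G → ∀ {m} (p : Path G m) → ¬ Path G (suc m) → Leaf G (proj₁ p zero)
  maximal-path-start-leaf acyclic p maximal _ _ v₀y v₀z
    with maximal-path-neighbour p maximal v₀y | maximal-path-neighbour p maximal v₀z
  ... | j , refl | k , refl =
    cong (proj₁ p) (toℕ-injective (trans (path-start-neighbour acyclic p j v₀y)
                                         (sym (path-start-neighbour acyclic p k v₀z))))

forest-leaf : ∀ {n} {G : Adj (suc n)} → Forest G → ¬ ¬ (∃ λ ℓ → Leaf G ℓ)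
forest-leaf {n} {G} (simple , acyclic) = do
  (m , p , maximal) ← ¬¬-last (Path G) trivial-path (λ (_ , v-injective , _) → ℕₚ.1+n≰n (injective⇒≤ v-injective))
  pure (proj₁ p zero , maximal-path-start-leaf simple acyclic p maximal)
  where
  trivial-path : Path G 0
  trivial-path = (λ _ → zero) , (λ { {zero} {zero} _ → refl }) , λ ()

ProperColouring : ∀ {n} → Adj n → Set
ProperColouring {n} G = Σ (Fin n → Bool) λ colour → ∀ x y → G x y ≡ true → colour x ≢ colour y

Forest-∘-injective : ∀ {m n} {G : Adj n} {f : Fin m → Fin n} → Forest G → Injective _≡_ _≡_ f →
  Forest (λ i j → G (f i) (f j))
Forest-∘-injective {f = f} ((G-sym , G-loopless) , acyclic) f-injective =
  ((λ i j → G-sym _ _) , (λ i → G-loopless _)) ,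
  λ (m , v , v-injective , v-adjacent , closing) →
    acyclic (m , f ∘ v , (λ eq → v-injective (f-injective eq)) , v-adjacent , closing)

insertAt-punchOut : ∀ {A : Set} {n} (xs : Vector A n) {ℓ y : Fin (suc n)} (a : A) (ℓ≢y : ℓ ≢ y) →
  insertAt xs ℓ a y ≡ xs (punchOut ℓ≢y)
insertAt-punchOut xs {ℓ} a ℓ≢y =
  trans (cong (insertAt xs ℓ a) (sym (punchIn-punchOut ℓ≢y))) (insertAt-punchIn xs ℓ a (punchOut ℓ≢y))

module _ {n : ℕ} {G : Adj (suc n)} (simple : Simple G) {ℓ : Fin (suc n)} (leaf : Leaf G ℓ)
         (colouring : ProperColouring (λ i j → G (punchIn ℓ i) (punchIn ℓ j))) where

  private
    G-sym : ∀ i j → G i j ≡ G j i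
    G-sym = proj₁ simple
    colour = proj₁ colouring
    proper = proj₂ colouring

  leaf-colour : Dec (∃ λ y → G ℓ y ≡ true) → Bool
  leaf-colour (yes (y , ℓy)) = not (colour (punchOut (adjacent⇒≢ simple ℓy)))
  leaf-colour (no _) = true

  leaf-colour-≢ : ∀ d {y} (ℓ≢y : ℓ ≢ y) → G ℓ y ≡ true → leaf-colour d ≢ colour (punchOut ℓ≢y)
  leaf-colour-≢ (yes (y₀ , ℓy₀)) ℓ≢y ℓy same =
    not-¬ refl (sym (trans (sym (cong (not ∘ colour) (punchOut-cong ℓ (leaf _ _ ℓy₀ ℓy)))) same))
  leaf-colour-≢ (no isolated) ℓ≢y ℓy _ = isolated (_ , ℓy)

  neighbour? : Dec (∃ λ y → G ℓ y ≡ true)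
  neighbour? = any? (λ y → G ℓ y Bool.≟ true)

  extended : Fin (suc n) → Bool
  extended = insertAt colour ℓ (leaf-colour neighbour?)

  extended-leaf : extended ℓ ≡ leaf-colour neighbour?
  extended-leaf = insertAt-lookup colour ℓ _

  extended-other : ∀ {y} (ℓ≢y : ℓ ≢ y) → extended y ≡ colour (punchOut ℓ≢y)
  extended-other = insertAt-punchOut colour _

  extended-leaf-≢ : ∀ {y} → ℓ ≢ y → G ℓ y ≡ true → extended ℓ ≢ extended y
  extended-leaf-≢ ℓ≢y ℓy same = leaf-colour-≢ neighbour? ℓ≢y ℓy (trans (sym extended-leaf) (trans same (extended-other ℓ≢y)))

  extended-proper : ∀ x y → G x y ≡ true → extended x ≢ extended y
  extended-proper x y xy with ℓ Fin.≟ x | ℓ Fin.≟ y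
  ... | yes refl | yes refl = contradiction refl (adjacent⇒≢ simple xy)
  ... | yes refl | no ℓ≢y = extended-leaf-≢ ℓ≢y xy
  ... | no ℓ≢x | yes refl = extended-leaf-≢ ℓ≢x (trans (G-sym ℓ x) xy) ∘ sym
  ... | no ℓ≢x | no ℓ≢y = λ same → proper (punchOut ℓ≢x) (punchOut ℓ≢y)
    (subst₂ (λ u v → G u v ≡ true) (sym (punchIn-punchOut ℓ≢x)) (sym (punchIn-punchOut ℓ≢y)) xy)
    (trans (sym (extended-other ℓ≢x)) (trans same (extended-other ℓ≢y)))

forest-colouring : ∀ n {G : Adj n} → Forest G → ¬ ¬ ProperColouring G
forest-colouring zero _ = pure ((λ ()) , λ ())
forest-colouring (suc n) {G} forest = do
  (ℓ , leaf) ← forest-leaf forest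
  colouring ← forest-colouring n (Forest-∘-injective forest (punchIn-injective ℓ _ _))
  pure (extended (proj₁ forest) leaf colouring , extended-proper (proj₁ forest) leaf colouring)

adjMatrix-sym : ∀ {n} {G : Adj n} → Simple G → ∀ x y → adjMatrix G x y ≡ adjMatrix G y x
adjMatrix-sym (G-sym , _) x y = cong ι (G-sym x y)

adjMatrix-monochrome : ∀ {n} {G : Adj n} ((colour , _) : ProperColouring G) →
  ∀ x y → colour x ≡ colour y → adjMatrix G x y ≡ 0ℚ
adjMatrix-monochrome {G = G} (_ , proper) x y same with G x y in xy
... | true = contradiction same (proper x y xy)
... | false = refl

forest-even-rank : ∀ {n r} {G : Adj n} → Forest G → IsRank (adjMatrix G) r → ¬ ¬ (∃ λ p → r ≡ p ℕ.+ p)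
forest-even-rank {n} {G = G} forest isRank = do
  colouring ← forest-colouring n forest
  Bipartite.even-rank (adjMatrix G) (proj₁ colouring) (adjMatrix-sym (proj₁ forest)) (adjMatrix-monochrome colouring) isRank

∣-∣-complement : ∀ {n} r₁ r₂ k₁ k₂ → r₁ ℕ.+ k₁ ≡ n → r₂ ℕ.+ k₂ ≡ n → ∣ r₂ - r₁ ∣ ≡ ∣ k₂ - k₁ ∣
∣-∣-complement {n} r₁ r₂ k₁ k₂ r₁+k₁≡n r₂+k₂≡n = begin
  ∣ r₂ - r₁ ∣                              ≡⟨ ℕₚ.∣m+n-m+o∣≡∣n-o∣ k₁ r₂ r₁ ⟨
  ∣ k₁ ℕ.+ r₂ - k₁ ℕ.+ r₁ ∣                ≡⟨ cong₂ ∣_-_∣ (ℕₚ.+-comm k₁ r₂) (trans (ℕₚ.+-comm k₁ r₁) r₁+k₁≡n) ⟩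
  ∣ r₂ ℕ.+ k₁ - n ∣                        ≡⟨ cong (λ m → ∣ r₂ ℕ.+ k₁ - m ∣) (sym r₂+k₂≡n) ⟩
  ∣ r₂ ℕ.+ k₁ - r₂ ℕ.+ k₂ ∣                ≡⟨ ℕₚ.∣-∣-comm (r₂ ℕ.+ k₁) _ ⟩
  ∣ r₂ ℕ.+ k₂ - r₂ ℕ.+ k₁ ∣                ≡⟨ ℕₚ.∣m+n-m+o∣≡∣n-o∣ r₂ k₂ k₁ ⟩
  ∣ k₂ - k₁ ∣                              ∎
  where open ≡-Reasoning

∣-∣≤1 : ∀ p₁ p₂ → p₂ ≤ suc p₁ → p₁ ≤ suc p₂ → ∣ p₂ - p₁ ∣ ≡ 0 ⊎ ∣ p₂ - p₁ ∣ ≡ 1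
∣-∣≤1 zero zero _ _ = inj₁ refl
∣-∣≤1 zero (suc zero) _ _ = inj₂ refl
∣-∣≤1 zero (suc (suc _)) (s≤s ()) _
∣-∣≤1 (suc zero) zero _ _ = inj₂ refl
∣-∣≤1 (suc (suc _)) zero _ (s≤s ())
∣-∣≤1 (suc p₁) (suc p₂) (s≤s p₂≤1+p₁) (s≤s p₁≤1+p₂) = ∣-∣≤1 p₁ p₂ p₂≤1+p₁ p₁≤1+p₂

double : ∀ p → p ℕ.+ p ≡ 2 ℕ.* p
double p = cong (p ℕ.+_) (sym (ℕₚ.+-identityʳ p))

halve-≤ : ∀ p q → q ℕ.+ q ≤ (p ℕ.+ p) ℕ.+ 2 → q ≤ suc p
halve-≤ p q q+q≤p+p+2 = ℕₚ.*-cancelˡ-≤ 2 (subst₂ _≤_ (double q) (double+2 p) q+q≤p+p+2)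
  where
  double+2 : ∀ p → (p ℕ.+ p) ℕ.+ 2 ≡ 2 ℕ.* suc p
  double+2 = solve-∀

even-close : ∀ {r₁ r₂} → r₂ ≤ r₁ ℕ.+ 2 → r₁ ≤ r₂ ℕ.+ 2 → (∃ λ p → r₁ ≡ p ℕ.+ p) → (∃ λ p → r₂ ≡ p ℕ.+ p) →
  ∣ r₂ - r₁ ∣ ≡ 0 ⊎ ∣ r₂ - r₁ ∣ ≡ 2
even-close r₂≤r₁+2 r₁≤r₂+2 (p₁ , refl) (p₂ , refl) =
  Sum.map scale scale (∣-∣≤1 p₁ p₂ (halve-≤ p₁ p₂ r₂≤r₁+2) (halve-≤ p₂ p₁ r₁≤r₂+2))
  where
  scale : ∀ {g} → ∣ p₂ - p₁ ∣ ≡ g → ∣ p₂ ℕ.+ p₂ - p₁ ℕ.+ p₁ ∣ ≡ 2 ℕ.* g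
  scale gap = trans (cong₂ ∣_-_∣ (double p₂) (double p₁)) (trans (sym (ℕₚ.*-distribˡ-∣-∣ 2 p₂ p₁)) (cong (2 ℕ.*_) gap))

corollary4 : ∀ {n : ℕ} (s : Fin n → ℕ) → Graphical s →
    (F : Adj n) → InForests s F →
    (a b c d : Fin n) → FSwitch F a b c d →
    (r₁ r₂ k₁ k₂ : ℕ) →
    IsRank (adjMatrix F) r₁ → IsRank (adjMatrix (switch F a b c d)) r₂ →
    IsNullity (adjMatrix F) k₁ → IsNullity (adjMatrix (switch F a b c d)) k₂ →
    (∣ r₂ - r₁ ∣ ≡ ∣ k₂ - k₁ ∣) × (∣ r₂ - r₁ ∣ ≡ 0 ⊎ ∣ r₂ - r₁ ∣ ≡ 2)
corollary4 _ _ F (forest , _) a b c d (nontrivial , forest′) r₁ r₂ k₁ k₂ rank₁ rank₂ nullity₁ nullity₂ =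
  decidable-stable ((∣ r₂ - r₁ ∣ ℕ.≟ ∣ k₂ - k₁ ∣) ×-dec ((∣ r₂ - r₁ ∣ ℕ.≟ 0) ⊎-dec (∣ r₂ - r₁ ∣ ℕ.≟ 2))) do
    r₁+k₁≡n ← rank+nullity≡n {A = adjMatrix F} rank₁ nullity₁
    r₂+k₂≡n ← rank+nullity≡n {A = adjMatrix (switch F a b c d)} rank₂ nullity₂
    (r₂≤r₁+2 , r₁≤r₂+2) ← rank-perturbation {A = adjMatrix F} rank₁ rank₂ (switch-directions a b c d) (switch-coefficients a b c d)
                            (adjMatrix-switch (proj₁ forest) nontrivial)
    r₁-even ← forest-even-rank forest rank₁
    r₂-even ← forest-even-rank forest′ rank₂
    pure (∣-∣-complement r₁ r₂ k₁ k₂ r₁+k₁≡n r₂+k₂≡n , even-close r₂≤r₁+2 r₁≤r₂+2 r₁-even r₂-even)
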